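{- Let $d\ge 1$ be an integer. Let $K_{d,d^d}$ be the complete bipartite graph with parts of sizes $d$ and $d^d$, and let $K^{1/2}_{d,d^d}$ be the graph obtained by subdividing every edge of $K_{d,d^d}$ exactly once. Then (i) $ch^*_{ON}(K^{1/2}_{d,d^d})\le 2$, (ii) $\chi_{ON}(K^{1/2}_{d,d^d})\le 3$, and (iii) $ch_{ON}(K^{1/2}_{d,d^d})\ge d+1$.
   Context: $N_G(v)$ is the open neighborhood of $v$. A CFON$^*$ coloring of $G$ colors a subset $V'\subseteq V(G)$ so that every vertex $v$ has, in $N_G(v)\cap V'$, a vertex whose color differs from the colors of all other vertices in $N_G(v)\cap V'$; if $V'=V(G)$ it is a CFON coloring, and $\chi_{ON}(G)$ is the minimum number of colors of a CFON coloring. For a $k$-assignment $\mathcal{L}=\{L_v\}$ ($|L_v|=k$), a list CFON$^*$ (resp. CFON) coloring additionally requires each colored vertex $v$ to receive a color from $L_v$; $ch^*_{ON}(G)$ (resp. $ch_{ON}(G)$) is the minimum $k$ such that such a coloring exists for every $k$-assignment. -}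

module Defs where

open import Data.Nat using (ℕ; _≤_; _<_; _^_; suc)
open import Data.Fin using (Fin)
open import Data.Maybe using (Maybe; just)
open import Data.Product using (Σ; ∃; _×_; _,_)
open import Relation.Binary.PropositionalEquality using (_≡_; _≢_)
open import Relation.Nullary using (¬_)
open import Function.Definitions using (Injective)

record Graph : Set₁ where
  field
    V   : Set
    _~_ : V → V → Set
open Graph public

-- CFON* colouring: a partial colouring c (c u ≡ nothing means u ∉ V').
-- Every vertex v has a coloured neighbour u whose colour x differs from
-- the colours of all other coloured neighbours of v.
IsCFONStar : (G : Graph) → (V G → Maybe ℕ) → Set
IsCFONStar G c = ∀ v → Σ (V G) λ u → (_~_ G v u) × Σ ℕ λ x → (c u ≡ just x) ×
                   (∀ w → _~_ G v w → w ≢ u → c w ≢ just x)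

IsCFON : (G : Graph) {C : Set} → (V G → C) → Set
IsCFON G c = ∀ v → Σ (V G) λ u → (_~_ G v u) × (∀ w → _~_ G v w → w ≢ u → c w ≢ c u)

χON≤ : Graph → ℕ → Set
χON≤ G m = Σ ℕ λ k → k ≤ m × Σ (V G → Fin k) λ c → IsCFON G c

Assignment : Graph → ℕ → Set
Assignment G k = Σ (V G → Fin k → ℕ) λ L → ∀ v → Injective _≡_ _≡_ (L v)

InList : (G : Graph) (k : ℕ) → Assignment G k → V G → ℕ → Set
InList G k (L , _) v x = Σ (Fin k) λ i → L v i ≡ x

StarChoosable : Graph → ℕ → Set
StarChoosable G k = (𝓛 : Assignment G k) →
  Σ (V G → Maybe ℕ) λ c → IsCFONStar G c × (∀ v x → c v ≡ just x → InList G k 𝓛 v x)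

Choosable : Graph → ℕ → Set
Choosable G k = (𝓛 : Assignment G k) →
  Σ (V G → ℕ) λ c → IsCFON G c × (∀ v → InList G k 𝓛 v (c v))

chStarON≤ : Graph → ℕ → Set
chStarON≤ G m = Σ ℕ λ k → k ≤ m × StarChoosable G k

chON≥ : Graph → ℕ → Set
chON≥ G m = ∀ k → k < m → ¬ Choosable G k

-- K^{1/2}_{d,d^d}: K_{d,d^d} with parts A = Fin d, B = Fin (d^d),
-- each edge ab subdivided by a new vertex s a b.

data SVtx (d : ℕ) : Set where
  a : Fin d → SVtx d
  b : Fin (d ^ d) → SVtx d
  s : Fin d → Fin (d ^ d) → SVtx d

data SAdj (d : ℕ) : SVtx d → SVtx d → Set where
  a-s : ∀ i j → SAdj d (a i) (s i j)
  s-a : ∀ i j → SAdj d (s i j) (a i)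
  b-s : ∀ i j → SAdj d (b j) (s i j)
  s-b : ∀ i j → SAdj d (s i j) (b j)

K½ : ℕ → Graph
K½ d = record { V = SVtx d ; _~_ = SAdj d }

-- Read a vertex b j as a function j : Fin d → Fin d. For the upper bounds fix a
-- retraction g of e (g j = j 0 and e i the constant function i, possible as d ≥ 1)
-- and colour s i j only when i = g j: then b j has exactly one coloured neighbour,
-- and a i sees s i (e i) with a colour that all its other coloured neighbours avoid;
-- a i is coloured and b j is not (or differently), which serves every s i j.
-- For the lower bound give a i the list of colours (i , t) and b j the list
-- (t , j t), t < k ≤ d. If each a i receives (i , τ i), then b τ receives some
-- (t , τ t), the colour of a t, and s t τ has two equally coloured neighbours.
module Submission where

open import Defs
open import Data.Nat using (ℕ; _≤_; _^_; suc; _≟_)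
open import Data.Nat.Properties using (≤-refl; ≤-pred)
open import Data.Fin using (Fin; toℕ; combine; inject≤; finToFun; funToFin)
  renaming (zero to fzero; suc to fsuc)
open import Data.Fin.Properties
  using (toℕ-injective; combine-injectiveˡ; combine-injectiveʳ; inject≤-injective; finToFun-funToFin)
  renaming (_≟_ to _≟ᶠ_)
open import Data.Maybe using (Maybe; just; nothing; map)
open import Data.Maybe.Properties using (just-injective)
open import Data.Product using (_×_; _,_; Σ; ∃; proj₁; proj₂)
open import Function using (_∘_)
open import Function.Definitions using (Injective)
open import Relation.Nullary using (¬_; yes; no; contradiction)
open import Relation.Binary.PropositionalEquality using (_≡_; _≢_; refl; sym; trans; cong; module ≡-Reasoning)

UniqueAt : {I : Set} → (I → Maybe ℕ) → I → Set
UniqueAt f i = Σ ℕ λ x → f i ≡ just x × (∀ i′ → i′ ≢ i → f i′ ≢ just x)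

uniqueAt-sole : {I : Set} (f : I → Maybe ℕ) (i : I) {x : ℕ} →
  f i ≡ just x → (∀ i′ → i′ ≢ i → f i′ ≡ nothing) → UniqueAt f i
uniqueAt-sole f i fi≡x others =
  _ , fi≡x , λ i′ i′≢i fi′≡x → nothing≢just (trans (sym (others i′ i′≢i)) fi′≡x)
  where
  nothing≢just : {x : ℕ} → nothing ≢ just x
  nothing≢just ()

isCFONStar-total⇒isCFON : (G : Graph) {C : Set} (code : C → ℕ) (c : V G → C) →
  IsCFONStar G (just ∘ code ∘ c) → IsCFON G c
isCFONStar-total⇒isCFON G code c cf v with cf v
... | u , v~u , _ , cu≡x , unique =
  u , v~u , λ w v~w w≢u cw≡cu → unique w v~w w≢u (trans (cong (just ∘ code) cw≡cu) cu≡x)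

listColouring : (G : Graph) {k : ℕ} → Assignment G k → (V G → Maybe (Fin k)) → V G → Maybe ℕ
listColouring G (L , _) choice v = map (L v) (choice v)

listColouring-inList : (G : Graph) {k : ℕ} (𝓛 : Assignment G k) (choice : V G → Maybe (Fin k)) →
  ∀ v x → listColouring G 𝓛 choice v ≡ just x → InList G k 𝓛 v x
listColouring-inList G 𝓛 choice v x eq with choice v | eq
... | just t | refl = t , refl

avoid : (L : Fin 2 → ℕ) → Injective _≡_ _≡_ L → (y : ℕ) → ∃ λ t → L t ≢ y
avoid L inj y with L fzero ≟ y
... | no L₀≢y = fzero , L₀≢y
... | yes L₀≡y = fsuc fzero , λ L₁≡y → 0≢1 (inj (trans L₀≡y (sym L₁≡y)))
  where
  0≢1 : fzero ≢ fsuc fzero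
  0≢1 ()

module _ {d : ℕ} where

  isCFONStar-K½ : (c : SVtx d → Maybe ℕ) →
    (∀ i → ∃ λ j → UniqueAt (λ j → c (s i j)) j) →
    (∀ j → ∃ λ i → UniqueAt (λ i → c (s i j)) i) →
    (∀ i j → Σ ℕ λ x → c (a i) ≡ just x × c (b j) ≢ just x) →
    IsCFONStar (K½ d) c
  isCFONStar-K½ c a-sees b-sees s-sees (a i) with a-sees i
  ... | j , x , cs≡x , others = s i j , a-s i j , x , cs≡x , unique
    where
    unique : ∀ w → SAdj d (a i) w → w ≢ s i j → c w ≢ just x
    unique _ (a-s _ j′) w≢s = others j′ (w≢s ∘ cong (s i))
  isCFONStar-K½ c a-sees b-sees s-sees (b j) with b-sees j
  ... | i , x , cs≡x , others = s i j , b-s i j , x , cs≡x , unique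
    where
    unique : ∀ w → SAdj d (b j) w → w ≢ s i j → c w ≢ just x
    unique _ (b-s i′ _) w≢s = others i′ (w≢s ∘ cong (λ i″ → s i″ j))
  isCFONStar-K½ c a-sees b-sees s-sees (s i j) with s-sees i j
  ... | x , ca≡x , cb≢x = a i , s-a i j , x , ca≡x , unique
    where
    unique : ∀ w → SAdj d (s i j) w → w ≢ a i → c w ≢ just x
    unique _ (s-a _ _) w≢a = λ _ → w≢a refl
    unique _ (s-b _ _) _ = cb≢x

  isCFON⇒a≢b : {C : Set} (c : SVtx d → C) → IsCFON (K½ d) c → ∀ i j → c (a i) ≢ c (b j)
  isCFON⇒a≢b c cf i j ca≡cb with cf (s i j)
  ... | _ , s-a _ _ , unique = unique (b j) (s-b i j) (λ ()) (sym ca≡cb)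
  ... | _ , s-b _ _ , unique = unique (a i) (s-a i j) (λ ()) ca≡cb

module Upper {d : ℕ} (g : Fin (d ^ d) → Fin d) (e : Fin d → Fin (d ^ d)) (g∘e : ∀ i → g (e i) ≡ i) where

  -- s i j is the unique-coloured neighbour of b j when i = g j, and also of a i when j = e i.
  data Role : Set where
    idle forB forAB : Role

  role : Fin d → Fin (d ^ d) → Role
  role i j with i ≟ᶠ g j | j ≟ᶠ e i
  ... | no _  | _     = idle
  ... | yes _ | no _  = forB
  ... | yes _ | yes _ = forAB

  role-e : ∀ i → role i (e i) ≡ forAB
  role-e i with i ≟ᶠ g (e i) | e i ≟ᶠ e i
  ... | no i≢gei | _  = contradiction (sym (g∘e i)) i≢gei
  ... | yes _ | no ei≢ei = contradiction refl ei≢ei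
  ... | yes _ | yes _ = refl

  role-≢e : ∀ i j → j ≢ e i → role i j ≢ forAB
  role-≢e i j j≢ei with i ≟ᶠ g j | j ≟ᶠ e i
  ... | no _  | _        = λ ()
  ... | yes _ | no _     = λ ()
  ... | yes _ | yes j≡ei = contradiction j≡ei j≢ei

  role-g : ∀ j → role (g j) j ≢ idle
  role-g j with g j ≟ᶠ g j | j ≟ᶠ e (g j)
  ... | no gj≢gj | _ = contradiction refl gj≢gj
  ... | yes _ | no _  = λ ()
  ... | yes _ | yes _ = λ ()

  role-≢g : ∀ i j → i ≢ g j → role i j ≡ idle
  role-≢g i j i≢gj with i ≟ᶠ g j
  ... | no _ = refl
  ... | yes i≡gj = contradiction i≡gj i≢gj

  roleColour : Role → Fin 3
  roleColour idle  = fzero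
  roleColour forAB = fsuc fzero
  roleColour forB  = fsuc (fsuc fzero)

  colour : SVtx d → Fin 3
  colour (a i)   = fzero
  colour (b j)   = fsuc fzero
  colour (s i j) = roleColour (role i j)

  isCFON-colour : IsCFON (K½ d) colour
  isCFON-colour = isCFONStar-total⇒isCFON (K½ d) toℕ colour (isCFONStar-K½ c a-sees b-sees s-sees)
    where
    c : SVtx d → Maybe ℕ
    c = just ∘ toℕ ∘ colour

    roleColour-≢forAB : ∀ r → r ≢ forAB → just (toℕ (roleColour r)) ≢ just 1
    roleColour-≢forAB idle  _ = λ ()
    roleColour-≢forAB forB  _ = λ ()
    roleColour-≢forAB forAB r≢forAB = contradiction refl r≢forAB

    roleColour-≢idle : ∀ r → r ≢ idle → just 0 ≢ just (toℕ (roleColour r))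
    roleColour-≢idle idle r≢idle = contradiction refl r≢idle
    roleColour-≢idle forB  _ = λ ()
    roleColour-≢idle forAB _ = λ ()

    a-sees : ∀ i → ∃ λ j → UniqueAt (λ j → c (s i j)) j
    a-sees i = e i , 1 , cong (just ∘ toℕ ∘ roleColour) (role-e i) ,
             λ j j≢ei → roleColour-≢forAB (role i j) (role-≢e i j j≢ei)

    b-sees : ∀ j → ∃ λ i → UniqueAt (λ i → c (s i j)) i
    b-sees j = g j , _ , refl , λ i i≢gj csij≡x →
      roleColour-≢idle (role (g j) j) (role-g j)
        (trans (sym (cong (just ∘ toℕ ∘ roleColour) (role-≢g i j i≢gj))) csij≡x)

    s-sees : ∀ i j → Σ ℕ λ x → c (a i) ≡ just x × c (b j) ≢ just x
    s-sees i j = 0 , refl , λ ()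

  module Star (𝓛 : Assignment (K½ d) 2) where

    L : SVtx d → Fin 2 → ℕ
    L = proj₁ 𝓛

    roleChoice : Fin d → Fin (d ^ d) → Role → Maybe (Fin 2)
    roleChoice i j idle  = nothing
    roleChoice i j forAB = just fzero
    roleChoice i j forB  = just (proj₁ (avoid (L (s i j)) (proj₂ 𝓛 (s i j)) (L (s i (e i)) fzero)))

    choice : SVtx d → Maybe (Fin 2)
    choice (a i)   = just fzero
    choice (b j)   = nothing
    choice (s i j) = roleChoice i j (role i j)

    c : SVtx d → Maybe ℕ
    c = listColouring (K½ d) 𝓛 choice

    roleChoice-avoids : ∀ i j r → r ≢ forAB → map (L (s i j)) (roleChoice i j r) ≢ just (L (s i (e i)) fzero)
    roleChoice-avoids i j idle  _ = λ ()
    roleChoice-avoids i j forB  _ = proj₂ (avoid (L (s i j)) (proj₂ 𝓛 (s i j)) _) ∘ just-injective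
    roleChoice-avoids i j forAB r≢forAB = contradiction refl r≢forAB

    roleChoice-coloured : ∀ i j r → r ≢ idle → ∃ λ x → map (L (s i j)) (roleChoice i j r) ≡ just x
    roleChoice-coloured i j idle r≢idle = contradiction refl r≢idle
    roleChoice-coloured i j forB  _ = _ , refl
    roleChoice-coloured i j forAB _ = _ , refl

    isCFONStar-c : IsCFONStar (K½ d) c
    isCFONStar-c = isCFONStar-K½ c a-sees b-sees s-sees
      where
      a-sees : ∀ i → ∃ λ j → UniqueAt (λ j → c (s i j)) j
      a-sees i = e i , _ , cong (map (L (s i (e i))) ∘ roleChoice i (e i)) (role-e i) ,
               λ j j≢ei → roleChoice-avoids i j (role i j) (role-≢e i j j≢ei)

      b-sees : ∀ j → ∃ λ i → UniqueAt (λ i → c (s i j)) i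
      b-sees j = g j , uniqueAt-sole (λ i → c (s i j)) (g j)
        (proj₂ (roleChoice-coloured (g j) j (role (g j) j) (role-g j)))
        (λ i i≢gj → cong (map (L (s i j)) ∘ roleChoice i j) (role-≢g i j i≢gj))

      s-sees : ∀ i j → Σ ℕ λ x → c (a i) ≡ just x × c (b j) ≢ just x
      s-sees i j = _ , refl , λ ()

  chStarON≤2 : chStarON≤ (K½ d) 2
  chStarON≤2 = 2 , ≤-refl , λ 𝓛 →
    Star.c 𝓛 , Star.isCFONStar-c 𝓛 , listColouring-inList (K½ d) 𝓛 (Star.choice 𝓛)

  χON≤3 : χON≤ (K½ d) 3
  χON≤3 = 3 , ≤-refl , colour , isCFON-colour

module Lower {d k : ℕ} (k≤d : k ≤ d) where

  ι : Fin k → Fin d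
  ι t = inject≤ t k≤d

  pair : Fin d → Fin d → ℕ
  pair x y = toℕ (combine x y)

  diagonalLists : SVtx d → Fin k → ℕ
  diagonalLists (a i)   t = pair i (ι t)
  diagonalLists (b j)   t = pair (ι t) (finToFun j (ι t))
  diagonalLists (s i j) t = toℕ t

  diagonalAssignment : Assignment (K½ d) k
  diagonalAssignment = diagonalLists , injective
    where
    injective : ∀ v → Injective _≡_ _≡_ (diagonalLists v)
    injective (a i) {t} {t′} eq =
      inject≤-injective k≤d k≤d t t′ (combine-injectiveʳ i (ι t) i (ι t′) (toℕ-injective eq))
    injective (b j) {t} {t′} eq =
      inject≤-injective k≤d k≤d t t′ (combine-injectiveˡ (ι t) _ (ι t′) _ (toℕ-injective eq))
    injective (s i j) eq = toℕ-injective eq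

  diagonal-collision : (c : SVtx d → ℕ) → (∀ v → InList (K½ d) k diagonalAssignment v (c v)) →
    ∃ λ i → ∃ λ j → c (a i) ≡ c (b j)
  diagonal-collision c inList = i , j , sym cb≡ca
    where
    open ≡-Reasoning
    τ : Fin d → Fin k
    τ i = proj₁ (inList (a i))
    j : Fin (d ^ d)
    j = funToFin (ι ∘ τ)
    t : Fin k
    t = proj₁ (inList (b j))
    i : Fin d
    i = ι t
    cb≡ca : c (b j) ≡ c (a i)
    cb≡ca = begin
      c (b j)                        ≡⟨ sym (proj₂ (inList (b j))) ⟩
      pair i (finToFun j i)          ≡⟨ cong (pair i) (finToFun-funToFin (ι ∘ τ) i) ⟩
      pair i (ι (τ i))               ≡⟨ proj₂ (inList (a i)) ⟩
      c (a i)                        ∎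

  ¬choosable : ¬ Choosable (K½ d) k
  ¬choosable choosable with choosable diagonalAssignment
  ... | c , isCFON-c , inList with diagonal-collision c inList
  ... | i , j , ca≡cb = isCFON⇒a≢b c isCFON-c i j ca≡cb

proposition4 : (d : ℕ) → 1 ≤ d →
    chStarON≤ (K½ d) 2 × χON≤ (K½ d) 3 × chON≥ (K½ d) (suc d)
proposition4 (suc m) _ =
  Upper.chStarON≤2 g e g∘e , Upper.χON≤3 g e g∘e , λ k k<d+1 → Lower.¬choosable (≤-pred k<d+1)
  where
  g : Fin (suc m ^ suc m) → Fin (suc m)
  g j = finToFun {suc m} {suc m} j fzero
  e : Fin (suc m) → Fin (suc m ^ suc m)
  e i = funToFin {suc m} {suc m} (λ _ → i)
  g∘e : ∀ i → g (e i) ≡ i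
  g∘e i = finToFun-funToFin {suc m} {suc m} (λ _ → i) fzero
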